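{- Let $r_1,\dots,r_n\in\mathbb{F}^N$ and $c\in[N]$. Then $$\mathcal{S}^{\{c\}}(r_1,\dots,r_n)=\sum_{\tau\subseteq[n]}(-1)^{|\tau|}\,|\tau|!\; r_\tau(c)\;\mathcal{S}\big(r[[n]\setminus\tau]\big).$$
   Context: $\mathbb{F}=\mathbb{F}_p$, $p$ prime. For a matrix $M$ with $s$ rows and $N'$ columns, $\mathcal{S}(M)=\sum_\rho\prod_{i=1}^s M_{i,\rho(i)}$ over injective $\rho:[s]\to[N']$. $\mathcal{S}(r_1,\dots,r_n)$ is $\mathcal{S}$ of the matrix with rows $r_1,\dots,r_n$; for $\sigma\subseteq[n]$, $\mathcal{S}(r[\sigma])$ is $\mathcal{S}$ of the matrix with rows $r_i$, $i\in\sigma$, with the convention $\mathcal{S}(r[\emptyset])=1$. For $T\subseteq[N]$, $\mathcal{S}^T$ is $\mathcal{S}$ applied after deleting the columns in $T$. For $\tau\subseteq[n]$, $r_\tau\in\mathbb{F}^N$ is the coordinatewise product $r_\tau(j)=\prod_{i\in\tau}r_i(j)$, with $r_\emptyset$ the all-ones vector. -}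

module Defs where

open import Level using (Level)
open import Data.Nat as ℕ using (ℕ; zero; suc; _!)
open import Data.Integer as Int using (ℤ)
open import Data.Integer.Properties as ℤP using ()
open import Data.Integer.Tactic.RingSolver using (solve-∀)
open import Data.Fin as Fin using (Fin; punchIn)
open import Data.Fin.Properties using (all?) renaming (_≟_ to _≟F_)
open import Data.Fin.Subset using (Subset; _∈_; ∁; ∣_∣; inside; outside)
open import Data.Fin.Subset.Properties using (_∈?_)
open import Data.Vec as Vec using ([]; _∷_)
open import Data.Vec.Functional as VF using ()
open import Data.List as List using (List; []; _∷_; _++_; map; concatMap; filter; allFin; length; foldr; lookup)
open import Data.Product using (Σ; _,_; proj₁; proj₂)
open import Relation.Nullary using (Dec; yes; no; does; _→-dec_)
open import Relation.Binary.PropositionalEquality as P using (_≡_; refl; cong; cong₂)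
open import Data.Bool using (if_then_else_)
open import Algebra.Bundles using (CommutativeRing)
open import Algebra.Structures using (IsCommutativeRing)
import Algebra.Definitions

-- The field F_p, modelled (setoid-style, since Agda has no quotient
-- types) as ℤ with equality "congruent modulo p".

_≡[mod_]_ : ℤ → ℕ → ℤ → Set
x ≡[mod p ] y = Σ ℤ λ k → x Int.- y ≡ k Int.* Int.+ p

module FpConstruction (p : ℕ) where
  open Int using (+_; _+_; _*_; -_; _-_)
  _≈_ : ℤ → ℤ → Set
  x ≈ y = x ≡[mod p ] y

  open P.≡-Reasoning

  lem1 : ∀ x y → y - x ≡ - (x - y)
  lem1 = solve-∀
  lem2 : ∀ x y z → x - z ≡ (x - y) + (y - z)
  lem2 = solve-∀
  lem3 : ∀ x x′ y y′ → (x + y) - (x′ + y′) ≡ (x - x′) + (y - y′)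
  lem3 = solve-∀
  lem4 : ∀ x x′ y y′ → (x * y) - (x′ * y′) ≡ (x - x′) * y + x′ * (y - y′)
  lem4 = solve-∀
  lem5 : ∀ a b x′ y p′ → (a * p′) * y + x′ * (b * p′) ≡ (a * y + x′ * b) * p′
  lem5 = solve-∀
  lem6 : ∀ x y → - x - - y ≡ - (x - y)
  lem6 = solve-∀

  ≡⇒≈ : ∀ {x y} → x ≡ y → x ≈ y
  ≡⇒≈ {x} refl = + 0 , P.trans (ℤP.+-inverseʳ x) (P.sym (ℤP.*-zeroˡ (+ p)))

  ≈-sym : ∀ {x y} → x ≈ y → y ≈ x
  ≈-sym {x} {y} (k , e) = - k , (begin
    y - x ≡⟨ lem1 x y ⟩
    - (x - y)    ≡⟨ cong -_ e ⟩
    - (k * + p)  ≡⟨ ℤP.neg-distribˡ-* k (+ p) ⟩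
    - k * + p    ∎)

  ≈-trans : ∀ {x y z} → x ≈ y → y ≈ z → x ≈ z
  ≈-trans {x} {y} {z} (a , e) (b , f) = a + b , (begin
    x - z ≡⟨ lem2 x y z ⟩
    (x - y) + (y - z)   ≡⟨ cong₂ _+_ e f ⟩
    a * + p + b * + p   ≡⟨ P.sym (ℤP.*-distribʳ-+ (+ p) a b) ⟩
    (a + b) * + p       ∎)

  +-cong : ∀ {x x′ y y′} → x ≈ x′ → y ≈ y′ → (x + y) ≈ (x′ + y′)
  +-cong {x} {x′} {y} {y′} (a , e) (b , f) = a + b , (begin
    (x + y) - (x′ + y′) ≡⟨ lem3 x x′ y y′ ⟩
    (x - x′) + (y - y′)   ≡⟨ cong₂ _+_ e f ⟩
    a * + p + b * + p     ≡⟨ P.sym (ℤP.*-distribʳ-+ (+ p) a b) ⟩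
    (a + b) * + p         ∎)

  *-cong : ∀ {x x′ y y′} → x ≈ x′ → y ≈ y′ → (x * y) ≈ (x′ * y′)
  *-cong {x} {x′} {y} {y′} (a , e) (b , f) = a * y + x′ * b , (begin
    (x * y) - (x′ * y′) ≡⟨ lem4 x x′ y y′ ⟩
    (x - x′) * y + x′ * (y - y′)    ≡⟨ cong₂ (λ u v → u * y + x′ * v) e f ⟩
    (a * + p) * y + x′ * (b * + p) ≡⟨ lem5 a b x′ y (+ p) ⟩
    (a * y + x′ * b) * + p          ∎)

  neg-cong : ∀ {x y} → x ≈ y → (- x) ≈ (- y)
  neg-cong {x} {y} (a , e) = - a , (begin
    - x - - y ≡⟨ lem6 x y ⟩
    - (x - y)    ≡⟨ cong -_ e ⟩
    - (a * + p)  ≡⟨ ℤP.neg-distribˡ-* a (+ p) ⟩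
    - a * + p    ∎)

  module Z = IsCommutativeRing ℤP.+-*-isCommutativeRing

  isCommutativeRing : IsCommutativeRing _≈_ _+_ _*_ -_ (+ 0) (+ 1)
  isCommutativeRing = record
    { isRing = record
      { +-isAbelianGroup = record
        { isGroup = record
          { isMonoid = record
            { isSemigroup = record
              { isMagma = record
                { isEquivalence = record
                  { refl = λ {x} → ≡⇒≈ {x} refl
                  ; sym = λ {x} {y} → ≈-sym {x} {y}
                  ; trans = λ {x} {y} {z} → ≈-trans {x} {y} {z} }
                ; ∙-cong = λ {x} {x′} {y} {y′} → +-cong {x} {x′} {y} {y′} }
              ; assoc = λ x y z → ≡⇒≈ (Z.+-assoc x y z) }
            ; identity = (λ x → ≡⇒≈ (Z.+-identityˡ x)) , (λ x → ≡⇒≈ (Z.+-identityʳ x)) }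
          ; inverse = (λ x → ≡⇒≈ (Z.-‿inverseˡ x)) , (λ x → ≡⇒≈ (Z.-‿inverseʳ x))
          ; ⁻¹-cong = λ {x} {y} → neg-cong {x} {y} }
        ; comm = λ x y → ≡⇒≈ (Z.+-comm x y) }
      ; *-cong = λ {x} {x′} {y} {y′} → *-cong {x} {x′} {y} {y′}
      ; *-assoc = λ x y z → ≡⇒≈ (Z.*-assoc x y z)
      ; *-identity = (λ x → ≡⇒≈ (Z.*-identityˡ x)) , (λ x → ≡⇒≈ (Z.*-identityʳ x))
      ; distrib = (λ x y z → ≡⇒≈ (Z.distribˡ x y z)) , (λ x y z → ≡⇒≈ (Z.distribʳ x y z)) }
    ; *-comm = λ x y → ≡⇒≈ (Z.*-comm x y) }

-- 𝔽 p : the ring ℤ/pℤ (a field when p is prime).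
𝔽 : ℕ → CommutativeRing _ _
𝔽 p = record { isCommutativeRing = FpConstruction.isCommutativeRing p }

module _ {c ℓ : Level} (R : CommutativeRing c ℓ) where
  open CommutativeRing R renaming (Carrier to A)

  Σ[_]_ : {B : Set} → List B → (B → A) → A
  Σ[ xs ] f = foldr (λ x acc → f x + acc) 0# xs

  Π[_]_ : {B : Set} → List B → (B → A) → A
  Π[ xs ] f = foldr (λ x acc → f x * acc) 1# xs

  ℕ→R : ℕ → A
  ℕ→R zero = 0#
  ℕ→R (suc n) = 1# + ℕ→R n

  _^_ : A → ℕ → A
  x ^ zero = 1#
  x ^ suc n = x * (x ^ n)

  allMaps : (s N′ : ℕ) → List (Fin s → Fin N′)
  allMaps zero N′ = (λ ()) ∷ []
  allMaps (suc s) N′ =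
    concatMap (λ ρ → map (λ j → j VF.∷ ρ) (allFin N′)) (allMaps s N′)

  Injective : {s N′ : ℕ} → (Fin s → Fin N′) → Set
  Injective ρ = ∀ i j → ρ i ≡ ρ j → i ≡ j

  injective? : {s N′ : ℕ} (ρ : Fin s → Fin N′) → Dec (Injective ρ)
  injective? ρ = all? λ i → all? λ j → (ρ i ≟F ρ j) →-dec (i ≟F j)

  𝒮 : {N′ : ℕ} → List (Fin N′ → A) → A
  𝒮 {N′} rows =
    Σ[ allMaps (length rows) N′ ] λ ρ →
      if does (injective? ρ)
        then Π[ allFin (length rows) ] (λ i → lookup rows i (ρ i))
        else 0#

  rowsOf : {n N : ℕ} → (Fin n → Fin N → A) → List (Fin N → A)
  rowsOf r = List.tabulate r

  rowsIn : {n N : ℕ} → (Fin n → Fin N → A) → Subset n → List (Fin N → A)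
  rowsIn {n} r σ = map r (filter (_∈? σ) (allFin n))

  delCol : {N : ℕ} → Fin N → {b : Level} {B : Set b} → (Fin N → B) → (Fin (ℕ.pred N) → B)
  delCol {suc N} c v j = v (punchIn c j)

  𝒮-del : {n N : ℕ} → Fin N → (Fin n → Fin N → A) → A
  𝒮-del c r = 𝒮 (rowsOf (λ i → delCol c (r i)))

  rProd : {n N : ℕ} → (Fin n → Fin N → A) → Subset n → Fin N → A
  rProd {n} r τ c = Π[ filter (_∈? τ) (allFin n) ] (λ i → r i c)

allSubsets : (n : ℕ) → List (Subset n)
allSubsets zero = [] ∷ []
allSubsets (suc n) = map (outside ∷_) (allSubsets n) ++ map (inside ∷_) (allSubsets n)

module Submission where

-- The identity holds over every commutative ring; primality of p is unused.
-- Fix the deleted column c and write, for weights W : ℕ → A and a function h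
-- of a list of rows,
--     expand W h r = Σ_{τ ⊆ [n]} W(|τ|) · r_τ(c) · h(r[∁τ]),
-- so the right-hand side of the lemma is  expand w 𝒮 r  with w(k) = (-1)^k k!.
--  (1) Column expansion: 𝒮(L) = f(L) + Σ_i L_i(c) f(L ∖ i), where f(L) is 𝒮
--      of L with column c deleted; i.e. 𝒮 = 𝒟 f where 𝒟 f = expand u f for
--      the weights u = 1,1,0,0,…. It is proved for a masked Laplace expansion
--      perm L C (rows L, available columns C), which agrees with 𝒮 and turns
--      column deletion into masking.
--  (2) Composition: expand W (𝒟 f) = expand (W ⋆) f with
--      (W ⋆)(k) = W(k) + k·W(k-1), by induction on the number of rows.
--  (3) Inversion: w ⋆ = δ₀ since (k+1)! = (k+1)·k!, and expand δ₀ f r = f(r).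
-- Hence 𝒮^{c}(r) = f(r) = expand w (𝒟 f) r = expand w 𝒮 r.

open import Defs
open import Data.Nat.Primality using (Prime)
open import Data.Nat as ℕ using (ℕ; zero; suc; _!)
open import Data.Fin using (Fin; zero; suc; punchIn)
open import Data.Fin.Properties using (0≢1+n; suc-injective; punchIn-injective; punchInᵢ≢i; all?) renaming (_≟_ to _≟F_)
open import Data.Fin.Subset using (Subset; ∁; ∣_∣; inside; outside)
open import Data.Fin.Subset.Properties using (_∈?_)
open import Data.List using (List; []; _∷_; _++_; map; concatMap; filter; allFin; length; foldr; lookup; tabulate)
import Data.List.Properties as LP
import Data.Vec as V
import Data.Vec.Functional as VF
open import Data.Bool using (Bool; true; false; T; _∧_; not; if_then_else_)
import Data.Bool.Properties as BP
open import Data.Product using (_×_; _,_; proj₁; proj₂)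
open import Data.Empty using (⊥-elim)
open import Relation.Nullary using (Dec; yes; no; does; _×-dec_; ¬_; T?)
open import Relation.Nullary.Decidable using (dec-true; dec-false; does-⇔)
open import Function using (_∘_; _⇔_; mk⇔; Equivalence)
open import Relation.Binary.PropositionalEquality as P using (_≡_; _≢_; refl; cong)
open import Algebra.Bundles using (CommutativeRing)

allFin-suc : ∀ n → allFin (suc n) ≡ zero ∷ map suc (allFin n)
allFin-suc n = cong (zero ∷_) (P.sym (LP.map-tabulate (λ i → i) suc))

foldr-allFin-suc : ∀ {b} {B : Set b} {n} (k : Fin (suc n) → B → B) (e : B)
  → foldr k e (allFin (suc n)) ≡ k zero (foldr (k ∘ suc) e (allFin n))
foldr-allFin-suc {n = n} k e =
  P.trans (cong (foldr k e) (allFin-suc n)) (cong (k zero) (LP.foldr-map k suc e (allFin n)))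

elements : ∀ {n} → Subset n → List (Fin n)
elements {n} σ = filter (_∈? σ) (allFin n)

filter-∈-map-suc : ∀ {n} b (σ : Subset n) (xs : List (Fin n))
  → filter (_∈? (b V.∷ σ)) (map suc xs) ≡ map suc (filter (_∈? σ) xs)
filter-∈-map-suc b σ [] = refl
filter-∈-map-suc b σ (x ∷ xs) with does (x ∈? σ)
... | true = cong (suc x ∷_) (filter-∈-map-suc b σ xs)
... | false = filter-∈-map-suc b σ xs

elements-outside : ∀ {n} (σ : Subset n) → elements (outside V.∷ σ) ≡ map suc (elements σ)
elements-outside {n} σ = P.trans (cong (filter (_∈? (outside V.∷ σ))) (allFin-suc n)) (filter-∈-map-suc outside σ (allFin n))

elements-inside : ∀ {n} (σ : Subset n) → elements (inside V.∷ σ) ≡ zero ∷ map suc (elements σ)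
elements-inside {n} σ = P.trans (cong (filter (_∈? (inside V.∷ σ))) (allFin-suc n)) (cong (zero ∷_) (filter-∈-map-suc inside σ (allFin n)))

Mask : ℕ → Set
Mask N = Fin N → Bool

remove : ∀ {N} → Mask N → Fin N → Mask N
remove C j k = C k ∧ not (does (k ≟F j))

remove-keeps : ∀ {N} (C : Mask N) {j k} → T (C k) → k ≢ j → T (remove C j k)
remove-keeps C {j} {k} Ck k≢j with k ≟F j
... | yes k≡j = ⊥-elim (k≢j k≡j)
... | no _ = Equivalence.from BP.T-∧ (Ck , _)

remove-keeps⁻ : ∀ {N} (C : Mask N) {j k} → T (remove C j k) → T (C k) × k ≢ j
remove-keeps⁻ C {j} {k} t with k ≟F j
... | yes _ = ⊥-elim (proj₂ (Equivalence.to BP.T-∧ t))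
... | no k≢j = proj₁ (Equivalence.to BP.T-∧ t) , k≢j

remove-comm : ∀ {N} (C : Mask N) i j k → remove (remove C i) j k ≡ remove (remove C j) i k
remove-comm C i j k = P.trans (BP.∧-assoc (C k) a b)
  (P.trans (cong (C k ∧_) (BP.∧-comm a b)) (P.sym (BP.∧-assoc (C k) b a)))
  where
  a b : Bool
  a = not (does (k ≟F i))
  b = not (does (k ≟F j))

module PermanentIdentity {c ℓ} (R : CommutativeRing c ℓ) where
  open CommutativeRing R renaming (Carrier to A; refl to ≈-refl; sym to ≈-sym; trans to ≈-trans) hiding (zero)
  open import Relation.Binary.Reasoning.Setoid setoid
  open import Algebra.Solver.Ring.NaturalCoefficients.Default commutativeSemiring
  open import Algebra.Properties.Ring ring using (-1*x≈-x)
  open import Algebra.Properties.Semiring.Mult semiring using (×1-homo-*) renaming (_×_ to _×ₙ_)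

  ≡⇒≈ : ∀ {x y} → x ≡ y → x ≈ y
  ≡⇒≈ refl = ≈-refl

  ∑[_]_ : {B : Set} → List B → (B → A) → A
  ∑[ xs ] f = Σ[_]_ R xs f

  ∏[_]_ : {B : Set} → List B → (B → A) → A
  ∏[ xs ] f = Π[_]_ R xs f

  ∑-cong : {B : Set} (xs : List B) {f g : B → A} → (∀ x → f x ≈ g x) → ∑[ xs ] f ≈ ∑[ xs ] g
  ∑-cong [] e = ≈-refl
  ∑-cong (x ∷ xs) e = +-cong (e x) (∑-cong xs e)

  ∑-zero : {B : Set} (xs : List B) → ∑[ xs ] (λ _ → 0#) ≈ 0#
  ∑-zero [] = ≈-refl
  ∑-zero (x ∷ xs) = ≈-trans (+-cong ≈-refl (∑-zero xs)) (+-identityˡ 0#)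

  ∑-+ : {B : Set} (xs : List B) (f g : B → A) → ∑[ xs ] (λ x → f x + g x) ≈ ∑[ xs ] f + ∑[ xs ] g
  ∑-+ [] f g = ≈-sym (+-identityˡ 0#)
  ∑-+ (x ∷ xs) f g = ≈-trans (+-cong ≈-refl (∑-+ xs f g))
    (solve 4 (λ a b c d → (a :+ b) :+ (c :+ d) := (a :+ c) :+ (b :+ d)) ≈-refl (f x) (g x) (∑[ xs ] f) (∑[ xs ] g))

  *-∑ : {B : Set} (a : A) (xs : List B) (f : B → A) → a * ∑[ xs ] f ≈ ∑[ xs ] (λ x → a * f x)
  *-∑ a [] f = zeroʳ a
  *-∑ a (x ∷ xs) f = ≈-trans (distribˡ a (f x) (∑[ xs ] f)) (+-cong ≈-refl (*-∑ a xs f))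

  ∑-++ : {B : Set} (xs ys : List B) (f : B → A) → ∑[ xs ++ ys ] f ≈ ∑[ xs ] f + ∑[ ys ] f
  ∑-++ [] ys f = ≈-sym (+-identityˡ _)
  ∑-++ (x ∷ xs) ys f = ≈-trans (+-cong ≈-refl (∑-++ xs ys f)) (≈-sym (+-assoc _ _ _))

  ∑-map : {B D : Set} (g : D → B) (xs : List D) (f : B → A) → ∑[ map g xs ] f ≈ ∑[ xs ] (f ∘ g)
  ∑-map g xs f = ≡⇒≈ (LP.foldr-map _ g 0# xs)

  ∑-concatMap : {B D : Set} (h : D → List B) (xs : List D) (f : B → A)
    → ∑[ concatMap h xs ] f ≈ ∑[ xs ] (λ x → ∑[ h x ] f)
  ∑-concatMap h [] f = ≈-refl
  ∑-concatMap h (x ∷ xs) f = ≈-trans (∑-++ (h x) (concatMap h xs) f) (+-cong ≈-refl (∑-concatMap h xs f))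

  ∑-swap : {B D : Set} (xs : List B) (ys : List D) (F : B → D → A)
    → ∑[ xs ] (λ x → ∑[ ys ] (F x)) ≈ ∑[ ys ] (λ y → ∑[ xs ] (λ x → F x y))
  ∑-swap [] ys F = ≈-sym (∑-zero ys)
  ∑-swap (x ∷ xs) ys F = ≈-trans (+-cong ≈-refl (∑-swap xs ys F)) (≈-sym (∑-+ ys (F x) (λ y → ∑[ xs ] (λ x → F x y))))

  ∑-allFin-suc : ∀ {n} (g : Fin (suc n) → A) → ∑[ allFin (suc n) ] g ≈ g zero + ∑[ allFin n ] (g ∘ suc)
  ∑-allFin-suc g = ≡⇒≈ (foldr-allFin-suc (λ x acc → g x + acc) 0#)

  ∑-punchIn : ∀ {M} (c′ : Fin (suc M)) (g : Fin (suc M) → A)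
    → ∑[ allFin (suc M) ] g ≈ g c′ + ∑[ allFin M ] (g ∘ punchIn c′)
  ∑-punchIn zero g = ∑-allFin-suc g
  ∑-punchIn {suc M} (suc c′) g = begin
    ∑[ allFin (suc (suc M)) ] g
      ≈⟨ ∑-allFin-suc g ⟩
    g zero + ∑[ allFin (suc M) ] (g ∘ suc)
      ≈⟨ +-cong ≈-refl (∑-punchIn c′ (g ∘ suc)) ⟩
    g zero + (g (suc c′) + ∑[ allFin M ] (g ∘ suc ∘ punchIn c′))
      ≈⟨ solve 3 (λ a b x → a :+ (b :+ x) := b :+ (a :+ x)) ≈-refl _ _ _ ⟩
    g (suc c′) + (g zero + ∑[ allFin M ] (g ∘ suc ∘ punchIn c′))
      ≈⟨ +-cong ≈-refl (≈-sym (∑-allFin-suc (g ∘ punchIn (suc c′)))) ⟩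
    g (suc c′) + ∑[ allFin (suc M) ] (g ∘ punchIn (suc c′)) ∎

  when : Bool → A → A
  when b x = if b then x else 0#

  when-congᵀ : ∀ b {x y} → (T b → x ≈ y) → when b x ≈ when b y
  when-congᵀ true e = e _
  when-congᵀ false e = ≈-refl

  when-false : ∀ {b} x → ¬ T b → when b x ≈ 0#
  when-false {true} x ¬b = ⊥-elim (¬b _)
  when-false {false} x ¬b = ≈-refl

  when-∧ : ∀ a b x y → when (a ∧ b) (x * y) ≈ when a (x * when b y)
  when-∧ true true x y = ≈-refl
  when-∧ true false x y = ≈-sym (zeroʳ x)
  when-∧ false b x y = ≈-refl

  ∑-when : {B : Set} (b : Bool) (xs : List B) (f : B → A) → ∑[ xs ] (λ x → when b (f x)) ≈ when b (∑[ xs ] f)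
  ∑-when true xs f = ≈-refl
  ∑-when false xs f = ∑-zero xs

  when-split : ∀ a b x → (T b → T a) → when a x ≈ when b x + when (a ∧ not b) x
  when-split true true x _ = ≈-sym (+-identityʳ _)
  when-split true false x _ = ≈-sym (+-identityˡ _)
  when-split false true x b⇒a = ⊥-elim (b⇒a _)
  when-split false false x _ = ≈-sym (+-identityˡ _)

  ∑-point : ∀ {N} (c′ : Fin N) (F : Fin N → A) → ∑[ allFin N ] (λ j → when (does (j ≟F c′)) (F j)) ≈ F c′
  ∑-point {suc N} c′ F = begin
    ∑[ allFin (suc N) ] g
      ≈⟨ ∑-punchIn c′ g ⟩
    g c′ + ∑[ allFin N ] (g ∘ punchIn c′)
      ≈⟨ +-cong (≡⇒≈ (cong (λ b → when b (F c′)) (dec-true (c′ ≟F c′) refl)))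
                (≈-trans (∑-cong (allFin N) (λ j → ≡⇒≈ (cong (λ b → when b (F (punchIn c′ j))) (dec-false (punchIn c′ j ≟F c′) (punchInᵢ≢i c′ j)))))
                         (∑-zero (allFin N))) ⟩
    F c′ + 0#
      ≈⟨ +-identityʳ _ ⟩
    F c′ ∎
    where
    g : Fin (suc N) → A
    g j = when (does (j ≟F c′)) (F j)

  ∑-split-at : ∀ {N} (C : Mask N) (c′ : Fin N) (F : Fin N → A) → T (C c′)
    → ∑[ allFin N ] (λ j → when (C j) (F j)) ≈ F c′ + ∑[ allFin N ] (λ j → when (remove C c′ j) (F j))
  ∑-split-at {N} C c′ F Cc′ = begin
    ∑[ allFin N ] (λ j → when (C j) (F j))
      ≈⟨ ∑-cong (allFin N) (λ j → when-split (C j) (does (j ≟F c′)) (F j) (available j)) ⟩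
    ∑[ allFin N ] (λ j → when (does (j ≟F c′)) (F j) + when (remove C c′ j) (F j))
      ≈⟨ ∑-+ (allFin N) _ _ ⟩
    ∑[ allFin N ] (λ j → when (does (j ≟F c′)) (F j)) + ∑[ allFin N ] (λ j → when (remove C c′ j) (F j))
      ≈⟨ +-cong (∑-point c′ F) ≈-refl ⟩
    F c′ + ∑[ allFin N ] (λ j → when (remove C c′ j) (F j)) ∎
    where
    available : ∀ j → T (does (j ≟F c′)) → T (C j)
    available j t with j ≟F c′
    ... | yes refl = Cc′

  Weights : Set c
  Weights = ℕ → A

  -- ℕ→R n is the library's n ×ₙ 1#, whose multiplicativity we reuse.
  ℕ→R≡×ₙ1 : ∀ n → ℕ→R R n ≡ n ×ₙ 1#
  ℕ→R≡×ₙ1 zero = refl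
  ℕ→R≡×ₙ1 (suc n) = cong (1# +_) (ℕ→R≡×ₙ1 n)

  ℕ→R-* : ∀ m n → ℕ→R R (m ℕ.* n) ≈ ℕ→R R m * ℕ→R R n
  ℕ→R-* m n = begin
    ℕ→R R (m ℕ.* n)           ≡⟨ ℕ→R≡×ₙ1 (m ℕ.* n) ⟩
    (m ℕ.* n) ×ₙ 1#            ≈⟨ ×1-homo-* m n ⟩
    (m ×ₙ 1#) * (n ×ₙ 1#)       ≡⟨ P.sym (P.cong₂ _*_ (ℕ→R≡×ₙ1 m) (ℕ→R≡×ₙ1 n)) ⟩
    ℕ→R R m * ℕ→R R n ∎

  w : Weights
  w k = _^_ R (- 1#) k * ℕ→R R (k !)

  -- (k+1)! = (k+1)·k! gives the recursion of w.
  w-suc : ∀ k → w (suc k) ≈ - (ℕ→R R (suc k) * w k)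
  w-suc k = begin
    (- 1# * s) * ℕ→R R (suc k ℕ.* k !)
      ≈⟨ *-cong ≈-refl (ℕ→R-* (suc k) (k !)) ⟩
    (- 1# * s) * (m * f)
      ≈⟨ solve 4 (λ t s m f → (t :* s) :* (m :* f) := t :* (m :* (s :* f))) ≈-refl (- 1#) s m f ⟩
    - 1# * (m * (s * f))
      ≈⟨ -1*x≈-x _ ⟩
    - (m * w k) ∎
    where
    s m f : A
    s = _^_ R (- 1#) k
    m = ℕ→R R (suc k)
    f = ℕ→R R (k !)

  δ₀ : Weights
  δ₀ zero = 1#
  δ₀ (suc _) = 0#

  u : Weights
  u zero = 1#
  u (suc k) = δ₀ k

  -- (W ⋆)(k) = W(k) + k·W(k-1): the weights of expand W ∘ 𝒟 (see expand-𝒟).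
  _⋆ : Weights → Weights
  (W ⋆) zero = W zero
  (W ⋆) (suc k) = W (suc k) + ℕ→R R (suc k) * W k

  ⋆-suc : ∀ W k → W k + ((W ∘ suc) ⋆) k ≈ (W ⋆) (suc k)
  ⋆-suc W zero = solve 2 (λ a b → a :+ b := b :+ (con 1 :+ con 0) :* a) ≈-refl (W 0) (W 1)
  ⋆-suc W (suc k) = solve 3 (λ a b m → a :+ (b :+ m :* a) := b :+ (con 1 :+ m) :* a) ≈-refl
    (W (suc k)) (W (suc (suc k))) (ℕ→R R (suc k))

  -- The factorial weights are inverse to u:  w ⋆ = δ₀.
  w⋆≈δ₀ : ∀ k → (w ⋆) k ≈ δ₀ k
  w⋆≈δ₀ zero = solve 0 (con 1 :* (con 1 :+ con 0) := con 1) ≈-refl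
  w⋆≈δ₀ (suc k) = ≈-trans (+-cong (w-suc k) ≈-refl) (-‿inverseˡ _)

  module Expansion {N : ℕ} (col : Fin N) where

    Row : Set c
    Row = Fin N → A

    expand : Weights → (List Row → A) → {n : ℕ} → (Fin n → Row) → A
    expand W h {n} r = ∑[ allSubsets n ] (λ τ → W ∣ τ ∣ * rProd R r τ col * h (rowsIn R r (∁ τ)))

    -- 𝒟 f L = f(L) + Σ_i L_i(col) · f(L ∖ i).
    𝒟 : (List Row → A) → List Row → A
    𝒟 f L = expand u f (lookup L)

    -- With no rows, only τ = ∅ appears.
    expand-[] : ∀ W h (r : Fin 0 → Row) → expand W h r ≈ W 0 * h []
    expand-[] W h r = solve 2 (λ a x → (a :* con 1) :* x :+ con 0 := a :* x) ≈-refl (W 0) (h [])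

    expand-cong-h : ∀ W {h h′} {n} (r : Fin n → Row) → (∀ L → h L ≈ h′ L) → expand W h r ≈ expand W h′ r
    expand-cong-h W {n = n} r e = ∑-cong (allSubsets n) (λ τ → *-cong ≈-refl (e _))

    expand-cong-W : ∀ {W W′} h {n} (r : Fin n → Row) → (∀ k → W k ≈ W′ k) → expand W h r ≈ expand W′ h r
    expand-cong-W h {n} r e = ∑-cong (allSubsets n) (λ τ → *-cong (*-cong (e _) ≈-refl) ≈-refl)

    expand-+W : ∀ W V h {n} (r : Fin n → Row) → expand W h r + expand V h r ≈ expand (λ k → W k + V k) h r
    expand-+W W V h {n} r = ≈-trans (≈-sym (∑-+ (allSubsets n) _ _)) (∑-cong (allSubsets n) (λ τ →
      solve 4 (λ a b p x → a :* p :* x :+ b :* p :* x := (a :+ b) :* p :* x) ≈-refl _ _ _ _))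

    expand-+h : ∀ W h₁ h₂ {n} (r : Fin n → Row) → expand W (λ L → h₁ L + h₂ L) r ≈ expand W h₁ r + expand W h₂ r
    expand-+h W h₁ h₂ {n} r = ≈-trans (∑-cong (allSubsets n) (λ τ → distribˡ _ _ _)) (∑-+ (allSubsets n) _ _)

    expand-*h : ∀ W h {n} (r : Fin n → Row) a → a * expand W h r ≈ expand W (λ L → a * h L) r
    expand-*h W h {n} r a = ≈-trans (*-∑ a (allSubsets n) _) (∑-cong (allSubsets n) (λ τ →
      solve 3 (λ a k x → a :* (k :* x) := k :* (a :* x)) ≈-refl a _ _))

    expand-∑h : {B : Set} (W : Weights) (xs : List B) (H : B → List Row → A) {n : ℕ} (r : Fin n → Row)
      → ∑[ xs ] (λ j → expand W (H j) r) ≈ expand W (λ L → ∑[ xs ] (λ j → H j L)) r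
    expand-∑h W xs H {n} r = ≈-trans (∑-swap xs (allSubsets n) _) (∑-cong (allSubsets n) (λ τ → ≈-sym (*-∑ _ xs _)))

    expand-0W : ∀ h {n} (r : Fin n → Row) → expand (λ _ → 0#) h r ≈ 0#
    expand-0W h {n} r = ≈-trans (∑-cong (allSubsets n) (λ τ → ≈-trans (*-cong (zeroˡ _) ≈-refl) (zeroˡ _))) (∑-zero (allSubsets n))

    expand-when : ∀ W b g {n} (r : Fin n → Row) → when b (expand W g r) ≈ expand W (λ L → when b (g L)) r
    expand-when W true g r = ≈-refl
    expand-when W false g {n} r = ≈-sym (≈-trans (∑-cong (allSubsets n) (λ τ → zeroʳ _)) (∑-zero (allSubsets n)))

    rProd-outside : ∀ {n} (r : Fin (suc n) → Row) (σ : Subset n) → rProd R r (outside V.∷ σ) col ≡ rProd R (r ∘ suc) σ col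
    rProd-outside r σ = P.trans (cong (λ xs → ∏[ xs ] (λ i → r i col)) (elements-outside σ)) (LP.foldr-map _ suc 1# (elements σ))

    rProd-inside : ∀ {n} (r : Fin (suc n) → Row) (σ : Subset n) → rProd R r (inside V.∷ σ) col ≡ r zero col * rProd R (r ∘ suc) σ col
    rProd-inside r σ = P.trans (cong (λ xs → ∏[ xs ] (λ i → r i col)) (elements-inside σ)) (cong (r zero col *_) (LP.foldr-map _ suc 1# (elements σ)))

    rowsIn-outside : ∀ {n} (r : Fin (suc n) → Row) (σ : Subset n) → rowsIn R r (outside V.∷ σ) ≡ rowsIn R (r ∘ suc) σ
    rowsIn-outside r σ = P.trans (cong (map r) (elements-outside σ)) (P.sym (LP.map-∘ (elements σ)))

    rowsIn-inside : ∀ {n} (r : Fin (suc n) → Row) (σ : Subset n) → rowsIn R r (inside V.∷ σ) ≡ r zero ∷ rowsIn R (r ∘ suc) σ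
    rowsIn-inside r σ = P.trans (cong (map r) (elements-inside σ)) (cong (r zero ∷_) (P.sym (LP.map-∘ (elements σ))))

    -- Split on whether τ contains the first row: if not, that row stays in
    -- the argument of h; if so, it contributes r₀(col) and shifts the weight.
    expand-peel : ∀ W h {n} (r : Fin (suc n) → Row)
      → expand W h r ≈ expand W (λ L → h (r zero ∷ L)) (r ∘ suc) + r zero col * expand (W ∘ suc) h (r ∘ suc)
    expand-peel W h {n} r = begin
      expand W h r
        ≈⟨ ∑-++ (map (outside V.∷_) (allSubsets n)) (map (inside V.∷_) (allSubsets n)) term ⟩
      ∑[ map (outside V.∷_) (allSubsets n) ] term + ∑[ map (inside V.∷_) (allSubsets n) ] term
        ≈⟨ +-cong (∑-map _ (allSubsets n) term) (∑-map _ (allSubsets n) term) ⟩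
      ∑[ allSubsets n ] (λ σ → term (outside V.∷ σ)) + ∑[ allSubsets n ] (λ σ → term (inside V.∷ σ))
        ≈⟨ +-cong (∑-cong (allSubsets n) without-first)
                  (≈-trans (∑-cong (allSubsets n) with-first) (≈-sym (*-∑ (r zero col) (allSubsets n) _))) ⟩
      expand W (λ L → h (r zero ∷ L)) (r ∘ suc) + r zero col * expand (W ∘ suc) h (r ∘ suc) ∎
      where
      term : Subset (suc n) → A
      term τ = W ∣ τ ∣ * rProd R r τ col * h (rowsIn R r (∁ τ))
      without-first : ∀ σ → term (outside V.∷ σ) ≈ W ∣ σ ∣ * rProd R (r ∘ suc) σ col * h (r zero ∷ rowsIn R (r ∘ suc) (∁ σ))
      without-first σ = *-cong (*-cong ≈-refl (≡⇒≈ (rProd-outside r σ))) (≡⇒≈ (cong h (rowsIn-inside r (∁ σ))))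
      with-first : ∀ σ → term (inside V.∷ σ) ≈ r zero col * (W (suc ∣ σ ∣) * rProd R (r ∘ suc) σ col * h (rowsIn R (r ∘ suc) (∁ σ)))
      with-first σ = ≈-trans (*-cong (*-cong ≈-refl (≡⇒≈ (rProd-inside r σ))) (≡⇒≈ (cong h (rowsIn-outside r (∁ σ)))))
        (solve 4 (λ a b p x → a :* (b :* p) :* x := b :* (a :* p :* x)) ≈-refl _ _ _ _)

    -- With weights δ₀ only τ = ∅ contributes.
    expand-δ₀ : ∀ h {n} (r : Fin n → Row) → expand δ₀ h r ≈ h (tabulate r)
    expand-δ₀ h {zero} r = ≈-trans (expand-[] δ₀ h r) (*-identityˡ _)
    expand-δ₀ h {suc n} r = begin
      expand δ₀ h r
        ≈⟨ expand-peel δ₀ h r ⟩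
      expand δ₀ (λ L → h (r zero ∷ L)) (r ∘ suc) + r zero col * expand (λ _ → 0#) h (r ∘ suc)
        ≈⟨ +-cong (expand-δ₀ (λ L → h (r zero ∷ L)) (r ∘ suc)) (≈-trans (*-cong ≈-refl (expand-0W h (r ∘ suc))) (zeroʳ _)) ⟩
      h (tabulate r) + 0#
        ≈⟨ +-identityʳ _ ⟩
      h (tabulate r) ∎

    𝒟-[] : ∀ f → 𝒟 f [] ≈ f []
    𝒟-[] f = ≈-trans (expand-[] u f (lookup [])) (*-identityˡ _)

    -- First-row recursion of 𝒟: either the first row is kept, or it is the
    -- deleted one.
    𝒟-∷ : ∀ f v L → 𝒟 f (v ∷ L) ≈ 𝒟 (λ L′ → f (v ∷ L′)) L + v col * f L
    𝒟-∷ f v L = ≈-trans (expand-peel u f (lookup (v ∷ L)))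
      (+-cong ≈-refl (*-cong ≈-refl (≈-trans (expand-δ₀ f (lookup L)) (≡⇒≈ (cong f (LP.tabulate-lookup L))))))

    expand-𝒟 : ∀ W f {n} (r : Fin n → Row) → expand W (𝒟 f) r ≈ expand (W ⋆) f r
    expand-𝒟 W f {zero} r = begin
      expand W (𝒟 f) r     ≈⟨ expand-[] W (𝒟 f) r ⟩
      W 0 * 𝒟 f []         ≈⟨ *-cong ≈-refl (𝒟-[] f) ⟩
      W 0 * f []           ≈⟨ ≈-sym (expand-[] (W ⋆) f r) ⟩
      expand (W ⋆) f r ∎
    expand-𝒟 W f {suc n} r = begin
      expand W (𝒟 f) r
        ≈⟨ expand-peel W (𝒟 f) r ⟩
      expand W (λ L → 𝒟 f (v ∷ L)) r′ + a * expand (W ∘ suc) (𝒟 f) r′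
        ≈⟨ +-cong (≈-trans (expand-cong-h W r′ (𝒟-∷ f v)) (expand-+h W (𝒟 f₀) (λ L → a * f L) r′))
                  (*-cong ≈-refl (expand-𝒟 (W ∘ suc) f r′)) ⟩
      (expand W (𝒟 f₀) r′ + expand W (λ L → a * f L) r′) + a * expand ((W ∘ suc) ⋆) f r′
        ≈⟨ +-cong (+-cong (expand-𝒟 W f₀ r′) (≈-sym (expand-*h W f r′ a))) ≈-refl ⟩
      (expand (W ⋆) f₀ r′ + a * expand W f r′) + a * expand ((W ∘ suc) ⋆) f r′
        ≈⟨ solve 4 (λ x a y z → (x :+ a :* y) :+ a :* z := x :+ a :* (y :+ z)) ≈-refl _ a _ _ ⟩
      expand (W ⋆) f₀ r′ + a * (expand W f r′ + expand ((W ∘ suc) ⋆) f r′)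
        ≈⟨ +-cong ≈-refl (*-cong ≈-refl (≈-trans (expand-+W W ((W ∘ suc) ⋆) f r′) (expand-cong-W f r′ (⋆-suc W)))) ⟩
      expand (W ⋆) f₀ r′ + a * expand ((W ⋆) ∘ suc) f r′
        ≈⟨ ≈-sym (expand-peel (W ⋆) f r) ⟩
      expand (W ⋆) f r ∎
      where
      v : Row
      v = r zero
      r′ : Fin n → Row
      r′ = r ∘ suc
      a : A
      a = r zero col
      f₀ : List Row → A
      f₀ L = f (v ∷ L)

    expand-w-𝒟 : ∀ f {n} (r : Fin n → Row) → expand w (𝒟 f) r ≈ f (tabulate r)
    expand-w-𝒟 f r = begin
      expand w (𝒟 f) r    ≈⟨ expand-𝒟 w f r ⟩
      expand (w ⋆) f r    ≈⟨ expand-cong-W f r w⋆≈δ₀ ⟩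
      expand δ₀ f r       ≈⟨ expand-δ₀ f r ⟩
      f (tabulate r) ∎

  perm : ∀ {N} → List (Fin N → A) → Mask N → A
  perm [] C = 1#
  perm {N} (v ∷ L) C = ∑[ allFin N ] (λ j → when (C j) (v j * perm L (remove C j)))

  perm-cong : ∀ {N} (L : List (Fin N → A)) {C C′ : Mask N} → (∀ k → C k ≡ C′ k) → perm L C ≈ perm L C′
  perm-cong [] e = ≈-refl
  perm-cong {N} (v ∷ L) {C} {C′} e = ∑-cong (allFin N) (λ j →
    ≈-trans (≡⇒≈ (cong (λ b → when b (v j * perm L (remove C j))) (e j)))
      (when-congᵀ (C′ j) (λ _ → *-cong ≈-refl (perm-cong L (λ k → cong (_∧ not (does (k ≟F j))) (e k))))))

  everything : ∀ {N} → Mask N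
  everything _ = true

  Placement : ∀ {s N} → Mask N → (Fin s → Fin N) → Set
  Placement C ρ = Injective R ρ × (∀ i → T (C (ρ i)))

  placement? : ∀ {s N} (C : Mask N) (ρ : Fin s → Fin N) → Dec (Placement C ρ)
  placement? C ρ = injective? R ρ ×-dec all? (λ i → T? (C (ρ i)))

  placement-∷ : ∀ {s N} (C : Mask N) (j : Fin N) (ρ : Fin s → Fin N)
    → Placement C (j VF.∷ ρ) ⇔ (T (C j) × Placement (remove C j) ρ)
  placement-∷ {s} C j ρ = mk⇔ to from
    where
    to : Placement C (j VF.∷ ρ) → T (C j) × Placement (remove C j) ρ
    to (inj , inC) = inC zero , (λ a b e → suc-injective (inj (suc a) (suc b) e))
      , (λ i → remove-keeps C (inC (suc i)) (λ ρi≡j → 0≢1+n (P.sym (inj (suc i) zero ρi≡j))))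
    from : T (C j) × Placement (remove C j) ρ → Placement C (j VF.∷ ρ)
    from (Cj , inj , inC′) = inj′ , inC
      where
      inj′ : Injective R (j VF.∷ ρ)
      inj′ zero zero e = refl
      inj′ zero (suc b) e = ⊥-elim (proj₂ (remove-keeps⁻ C (inC′ b)) (P.sym e))
      inj′ (suc a) zero e = ⊥-elim (proj₂ (remove-keeps⁻ C (inC′ a)) e)
      inj′ (suc a) (suc b) e = cong suc (inj a b e)
      inC : ∀ i → T (C ((j VF.∷ ρ) i))
      inC zero = Cj
      inC (suc i) = proj₁ (remove-keeps⁻ C (inC′ i))

  permByMaps : ∀ {N} → List (Fin N → A) → Mask N → A
  permByMaps {N} L C = ∑[ allMaps R (length L) N ] (λ ρ →
    when (does (placement? C ρ)) (∏[ allFin (length L) ] (λ i → lookup L i (ρ i))))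

  𝒮≈permByMaps : ∀ {N} (L : List (Fin N → A)) → 𝒮 R L ≈ permByMaps L everything
  𝒮≈permByMaps {N} L = ∑-cong (allMaps R (length L) N) (λ ρ →
    ≡⇒≈ (cong (λ b → when b (∏[ allFin (length L) ] (λ i → lookup L i (ρ i))))
      (does-⇔ (mk⇔ (λ i → i , λ _ → _) proj₁) (injective? R ρ) (placement? everything ρ))))

  -- Summing over the image of the first row recovers the Laplace expansion.
  permByMaps≈perm : ∀ {N} (L : List (Fin N → A)) (C : Mask N) → permByMaps L C ≈ perm L C
  permByMaps≈perm {N} [] C with placement? {0} {N} C (λ ())
  ... | yes _ = +-identityʳ _
  ... | no ¬p = ⊥-elim (¬p ((λ ()) , (λ ())))
  permByMaps≈perm {N} (v ∷ L) C = begin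
    permByMaps (v ∷ L) C
      ≈⟨ ∑-concatMap (λ ρ → map (VF._∷ ρ) (allFin N)) (allMaps R s N) G ⟩
    ∑[ allMaps R s N ] (λ ρ → ∑[ map (VF._∷ ρ) (allFin N) ] G)
      ≈⟨ ∑-cong (allMaps R s N) (λ ρ → ∑-map (VF._∷ ρ) (allFin N) G) ⟩
    ∑[ allMaps R s N ] (λ ρ → ∑[ allFin N ] (λ j → G (j VF.∷ ρ)))
      ≈⟨ ∑-swap (allMaps R s N) (allFin N) (λ ρ j → G (j VF.∷ ρ)) ⟩
    ∑[ allFin N ] (λ j → ∑[ allMaps R s N ] (λ ρ → G (j VF.∷ ρ)))
      ≈⟨ ∑-cong (allFin N) (λ j → ≈-trans (∑-cong (allMaps R s N) (first-row j)) (∑-when (C j) (allMaps R s N) _)) ⟩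
    ∑[ allFin N ] (λ j → when (C j) (∑[ allMaps R s N ] (λ ρ → v j * rest j ρ)))
      ≈⟨ ∑-cong (allFin N) (λ j → when-congᵀ (C j) (λ _ →
           ≈-trans (≈-sym (*-∑ (v j) (allMaps R s N) (rest j))) (*-cong ≈-refl (permByMaps≈perm L (remove C j))))) ⟩
    perm (v ∷ L) C ∎
    where
    s : ℕ
    s = length L
    G : (Fin (suc s) → Fin N) → A
    G ρ = when (does (placement? C ρ)) (∏[ allFin (suc s) ] (λ i → lookup (v ∷ L) i (ρ i)))
    rest : Fin N → (Fin s → Fin N) → A
    rest j ρ = when (does (placement? (remove C j) ρ)) (∏[ allFin s ] (λ i → lookup L i (ρ i)))
    ∏-first : ∀ j ρ → ∏[ allFin (suc s) ] (λ i → lookup (v ∷ L) i ((j VF.∷ ρ) i)) ≡ v j * ∏[ allFin s ] (λ i → lookup L i (ρ i))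
    ∏-first j ρ = foldr-allFin-suc (λ i acc → lookup (v ∷ L) i ((j VF.∷ ρ) i) * acc) 1#
    first-row : ∀ j ρ → G (j VF.∷ ρ) ≈ when (C j) (v j * rest j ρ)
    first-row j ρ = ≈-trans
      (≡⇒≈ (P.cong₂ when (does-⇔ (placement-∷ C j ρ) (placement? C (j VF.∷ ρ)) (T? (C j) ×-dec placement? (remove C j) ρ)) (∏-first j ρ)))
      (when-∧ (C j) (does (placement? (remove C j) ρ)) (v j) _)

  𝒮≈perm : ∀ {N} (L : List (Fin N → A)) → 𝒮 R L ≈ perm L everything
  𝒮≈perm L = ≈-trans (𝒮≈permByMaps L) (permByMaps≈perm L everything)

  perm-delete : ∀ {M} (c′ : Fin (suc M)) (L : List (Fin (suc M) → A)) (C : Mask (suc M)) → ¬ T (C c′)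
    → perm (map (_∘ punchIn c′) L) (C ∘ punchIn c′) ≈ perm L C
  perm-delete c′ [] C _ = ≈-refl
  perm-delete {M} c′ (v ∷ L) C c′∉C = ≈-sym (begin
    perm (v ∷ L) C
      ≈⟨ ∑-punchIn c′ g ⟩
    g c′ + ∑[ allFin M ] (g ∘ punchIn c′)
      ≈⟨ ≈-trans (+-cong (when-false _ c′∉C) ≈-refl) (+-identityˡ _) ⟩
    ∑[ allFin M ] (g ∘ punchIn c′)
      ≈⟨ ∑-cong (allFin M) (λ j → when-congᵀ (C (punchIn c′ j)) (λ _ → *-cong ≈-refl (≈-sym (remaining j)))) ⟩
    perm (map (_∘ punchIn c′) (v ∷ L)) (C ∘ punchIn c′) ∎)
    where
    g : Fin (suc M) → A
    g j = when (C j) (v j * perm L (remove C j))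
    remaining : ∀ j → perm (map (_∘ punchIn c′) L) (remove (C ∘ punchIn c′) j) ≈ perm L (remove C (punchIn c′ j))
    remaining j = ≈-trans
      (perm-cong (map (_∘ punchIn c′) L) (λ k → cong (λ b → C (punchIn c′ k) ∧ not b)
        (does-⇔ (mk⇔ (cong (punchIn c′)) (punchIn-injective c′ k j)) (k ≟F j) (punchIn c′ k ≟F punchIn c′ j))))
      (perm-delete c′ L (remove C (punchIn c′ j)) (c′∉C ∘ proj₁ ∘ remove-keeps⁻ C))

  𝒮-del≈perm : ∀ {n N} (c′ : Fin N) (r : Fin n → Fin N → A) → 𝒮-del R c′ r ≈ perm (tabulate r) (remove everything c′)
  𝒮-del≈perm {N = suc N} c′ r = begin
    𝒮-del R c′ r
      ≈⟨ 𝒮≈perm (tabulate (λ i → r i ∘ punchIn c′)) ⟩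
    perm (tabulate (λ i → r i ∘ punchIn c′)) everything
      ≡⟨ cong (λ L → perm L everything) (P.sym (LP.map-tabulate r (_∘ punchIn c′))) ⟩
    perm (map (_∘ punchIn c′) (tabulate r)) everything
      ≈⟨ perm-cong (map (_∘ punchIn c′) (tabulate r)) (λ k → P.sym (cong not (dec-false (punchIn c′ k ≟F c′) (punchInᵢ≢i c′ k)))) ⟩
    perm (map (_∘ punchIn c′) (tabulate r)) (remove everything c′ ∘ punchIn c′)
      ≈⟨ perm-delete c′ (tabulate r) (remove everything c′) (λ t → proj₂ (remove-keeps⁻ everything {c′} {c′} t) refl) ⟩
    perm (tabulate r) (remove everything c′) ∎

  -- Expansion along an available column col: either no row uses col, or
  -- row i does and the other rows avoid it.
  perm-column : ∀ {N} (col : Fin N) (L : List (Fin N → A)) (C : Mask N) → T (C col)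
    → perm L C ≈ Expansion.𝒟 col (λ L′ → perm L′ (remove C col)) L
  perm-column col [] C _ = ≈-sym (Expansion.𝒟-[] col (λ L′ → perm L′ (remove C col)))
  perm-column {N} col (v ∷ L) C col∈C = begin
    perm (v ∷ L) C
      ≈⟨ ∑-split-at C col (λ j → v j * perm L (remove C j)) col∈C ⟩
    v col * perm L C′ + ∑[ allFin N ] (λ j → when (C′ j) (v j * perm L (remove C j)))
      ≈⟨ +-cong ≈-refl (≈-trans (∑-cong (allFin N) via-column) (expand-∑h u (allFin N) H (lookup L))) ⟩
    v col * perm L C′ + 𝒟 (λ L′ → perm (v ∷ L′) C′) L
      ≈⟨ +-comm _ _ ⟩
    𝒟 (λ L′ → perm (v ∷ L′) C′) L + v col * perm L C′
      ≈⟨ ≈-sym (𝒟-∷ (λ L′ → perm L′ C′) v L) ⟩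
    𝒟 (λ L′ → perm L′ C′) (v ∷ L) ∎
    where
    open Expansion col
    C′ : Mask N
    C′ = remove C col
    H : Fin N → List (Fin N → A) → A
    H j L′ = when (C′ j) (v j * perm L′ (remove C′ j))
    -- For j ≠ col the expansion applies to the smaller mask C ∖ j.
    via-column : ∀ j → when (C′ j) (v j * perm L (remove C j)) ≈ 𝒟 (H j) L
    via-column j = ≈-trans (when-congᵀ (C′ j) (λ j∈C′ → begin
        v j * perm L (remove C j)
          ≈⟨ *-cong ≈-refl (perm-column col L (remove C j)
               (remove-keeps C col∈C (λ col≡j → proj₂ (remove-keeps⁻ C j∈C′) (P.sym col≡j)))) ⟩
        v j * 𝒟 (λ L′ → perm L′ (remove (remove C j) col)) L
          ≈⟨ expand-*h u (λ L′ → perm L′ (remove (remove C j) col)) (lookup L) (v j) ⟩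
        𝒟 (λ L′ → v j * perm L′ (remove (remove C j) col)) L
          ≈⟨ expand-cong-h u (lookup L) (λ L′ → *-cong ≈-refl (perm-cong L′ (remove-comm C j col))) ⟩
        𝒟 (λ L′ → v j * perm L′ (remove C′ j)) L ∎))
      (expand-when u (C′ j) (λ L′ → v j * perm L′ (remove C′ j)) (lookup L))

  column-deletion : ∀ {n N} (r : Fin n → Fin N → A) (col : Fin N)
    → 𝒮-del R col r ≈ Expansion.expand col w (𝒮 R) r
  column-deletion r col = begin
    𝒮-del R col r       ≈⟨ 𝒮-del≈perm col r ⟩
    f (tabulate r)       ≈⟨ ≈-sym (expand-w-𝒟 f r) ⟩
    expand w (𝒟 f) r     ≈⟨ expand-cong-h w r (λ L → ≈-sym (≈-trans (𝒮≈perm L) (perm-column col L everything _))) ⟩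
    expand w (𝒮 R) r ∎
    where
    open Expansion col
    -- 𝒮 of a list of rows with column col deleted, expressed through perm.
    f : List Row → A
    f L = perm L (remove everything col)

lemma2p5 : (p : ℕ) → Prime p → (n N : ℕ)
    → (r : Fin n → Fin N → CommutativeRing.Carrier (𝔽 p)) → (c : Fin N)
    → let open CommutativeRing (𝔽 p) in
    𝒮-del (𝔽 p) c r
    ≈ Σ[_]_ (𝔽 p) (allSubsets n) (λ τ →
    ((_^_ (𝔽 p) (- 1#) ∣ τ ∣) * ℕ→R (𝔽 p) (∣ τ ∣ !))
    * rProd (𝔽 p) r τ c
    * 𝒮 (𝔽 p) (rowsIn (𝔽 p) r (∁ τ)))
lemma2p5 p _ n N r c = PermanentIdentity.column-deletion (𝔽 p) r c
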